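{- For every $m\ge 2$, the humble sequence is the reverse of the greedy sequence.
   Context: Let $m\ge2$ and start with nested sets $S_0\subset S_1\subset\cdots\subset S_m$ with $\#S_i=i$ (e.g. $S_i=\{1,\ldots,i\}$). For $1\le i\le m-1$ let $S_i^*=S_{i-1}\cup(S_{i+1}\setminus S_i)$ with respect to the current chain. The greedy sequence is the output $G$ of: set $G=[\ ]$, $\mathcal{S}=\{S_1,\ldots,S_m\}$, $J=\{1,\ldots,m-1\}$; while $J\ne\emptyset$: let $j=\max J$, append $j$ to $G$, replace $S_j$ by $S_j^*$, add the new $S_j$ to $\mathcal{S}$, and set $J=\{i\in\{1,\ldots,m-1\}:S_i^*\notin\mathcal{S}\}$; return $G$. The humble sequence is the output of the same procedure with $j=\min J$ in place of $j=\max J$ (i.e. always alter the set of smallest possible cardinality whose alteration has not been seen before). -}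

module Defs where

open import Data.Bool using (Bool; true; false; if_then_else_)
import Data.Bool as B
open import Data.Nat using (ℕ; zero; suc; _∸_; _⊔_; _⊓_; _<ᵇ_; _≡ᵇ_)
open import Data.Fin using (Fin; toℕ)
open import Data.Fin.Subset using (Subset; _∪_; _∩_; ∁)
open import Data.Vec using (tabulate)
open import Data.Vec.Properties using (≡-dec)
open import Data.List using (List; []; _∷_; map; upTo; filter; foldr)
open import Data.List.Relation.Unary.Any using (any?)
open import Data.Maybe using (Maybe; just; nothing)
import Data.Maybe as M
open import Relation.Nullary using (¬?)
open import Relation.Binary.PropositionalEquality using (_≡_)
open import Relation.Binary.Definitions using (DecidableEquality)

-- Subsets of S_m = {1,…,m}, encoded as subsets of Fin m (element k ↦ k+1).
_≟ₛ_ : {m : ℕ} → DecidableEquality (Subset m)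
_≟ₛ_ = ≡-dec B._≟_

initial : (m i : ℕ) → Subset m
initial m i = tabulate (λ k → toℕ k <ᵇ i)

-- A chain is the current family S_0, S_1, …, S_m (indexed by ℕ; indices > m unused).
Chain : ℕ → Set
Chain m = ℕ → Subset m

-- S_i^* = S_{i-1} ∪ (S_{i+1} \ S_i) with respect to the current chain (used for 1 ≤ i ≤ m-1).
star : {m : ℕ} → Chain m → ℕ → Subset m
star c i = c (i ∸ 1) ∪ (c (suc i) ∩ ∁ (c i))

update : {m : ℕ} → Chain m → ℕ → Subset m → Chain m
update c j X k = if k ≡ᵇ j then X else c k

indices : ℕ → List ℕ
indices m = map suc (upTo (m ∸ 1))

computeJ : {m : ℕ} → Chain m → List (Subset m) → List ℕ
computeJ {m} c seen = filter (λ i → ¬? (any? (λ X → star c i ≟ₛ X) seen)) (indices m)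

-- selection rules on a nonempty list i ∷ is
maxSel : ℕ → List ℕ → ℕ
maxSel i is = foldr _⊔_ i is

minSel : ℕ → List ℕ → ℕ
minSel i is = foldr _⊓_ i is

-- The while-loop, run with a fuel bound; returns nothing if fuel runs out
-- before J becomes empty, and just G (the output sequence) otherwise.
run : {m : ℕ} → (ℕ → List ℕ → ℕ) → ℕ → Chain m → List (Subset m) → List ℕ → Maybe (List ℕ)
run sel zero c seen J = nothing
run sel (suc n) c seen [] = just []
run sel (suc n) c seen (i ∷ is) =
  let j    = sel i is
      new  = star c j
      c'   = update c j new
      seen' = new ∷ seen
  in M.map (j ∷_) (run sel n c' seen' (computeJ c' seen'))

procedure : (ℕ → List ℕ → ℕ) → (m fuel : ℕ) → Maybe (List ℕ)
procedure sel m fuel =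
  run sel fuel (initial m) (map (initial m) (map suc (upTo m))) (indices m)

greedy : (m fuel : ℕ) → Maybe (List ℕ)
greedy = procedure maxSel

humble : (m fuel : ℕ) → Maybe (List ℕ)
humble = procedure minSel

module Submission where

-- A chain c is saturated on [a,b] if each step c k ⊂ c (k+1), a ≤ k < b, adds
-- one element; X is an inner set of [a,b] if c a ⊆ X ⊆ c b and X ≠ c a.  The
-- key fact is an exchange lemma: if A ⊂ C ⊂ D add x and then y, the altered
-- set A ∪ (D \ C) = A + y gives a saturated chain A ⊂ A + y ⊂ D adding y, x.
--
-- After generalities on traces of `run`, on J and on saturated chains, we show
-- by induction on e (with b = a+e+1): if the seen inner sets of [a,b] are
-- exactly c (a+1), …, c b, the greedy loop emits greedySeq a e, namely
-- greedySeq (a+1) (e-1), then a+1, …, b-1, then greedySeq a (e-1).  It visits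
-- the inner sets containing the element w added at a, sweeps w up to the top,
-- and visits those avoiding w.  Dually the humble loop emits humbleSeq a e,
-- sweeping the element added at b-1 down.  Either way all inner sets end up
-- seen, so J = [].  Finally humbleSeq = reverse ∘ greedySeq, and the chain
-- S_i = {1,…,i} on [0,m] meets the starting hypotheses.

open import Defs
open import Data.Nat using (ℕ; zero; suc; _+_; _≤_; _<_; _∸_; _≡ᵇ_; z≤n; s≤s)
open import Data.Nat.Properties
open import Data.Bool using (true; false)
open import Data.Bool.Properties using (T-≡)
open import Data.Vec.Properties using (lookup∘tabulate; lookup⇒[]=; []=⇒lookup)
open import Function.Bundles using (Equivalence)
open import Data.Fin using (Fin; toℕ; fromℕ<)
import Data.Fin.Properties as Fin
open import Data.Fin.Subset using (Subset; _∪_; _∩_; ∁; _∈_; _∉_; _⊆_)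
open import Data.Fin.Subset.Properties
  using (x∈p∪q⁺; x∈p∪q⁻; x∈p∩q⁺; x∈p∩q⁻; x∈∁p⇒x∉p; x∉p⇒x∈∁p; ⊆-antisym; _∈?_)
open import Data.List using (List; []; _∷_; _++_; _∷ʳ_; map; upTo; length; reverse)
open import Data.List.Relation.Unary.Any using (here; there; any?)
import Data.List.Relation.Unary.All as All
open import Data.List.Membership.Propositional using () renaming (_∈_ to _∈ˡ_)
open import Data.List.Membership.Propositional.Properties
  using (∈-map⁺; ∈-map⁻; ∈-upTo⁺; ∈-upTo⁻; ∈-filter⁺; ∈-filter⁻)
open import Data.List.Properties using (filter-all; filter-none; reverse-++; unfold-reverse; ++-assoc; ++-identityʳ; length-reverse)
open import Data.Maybe using (just)
import Data.Maybe as Maybe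
open import Data.Maybe.Properties using (map-id)
open import Data.Product using (_,_; proj₁; proj₂; ∃; ∃-syntax; _×_)
open import Data.Sum using (_⊎_; inj₁; inj₂; map₂)
open import Data.Empty using (⊥-elim)
open import Relation.Nullary using (¬_; ¬?; Dec; yes; no)
open import Relation.Nullary.Decidable using (_×-dec_)
open import Relation.Binary.PropositionalEquality
open import Relation.Binary.Definitions using (tri<; tri≈; tri>)

≡ᵇ-refl : ∀ n → (n ≡ᵇ n) ≡ true
≡ᵇ-refl zero = refl
≡ᵇ-refl (suc n) = ≡ᵇ-refl n

≢⇒≡ᵇ-false : ∀ k j → k ≢ j → (k ≡ᵇ j) ≡ false
≢⇒≡ᵇ-false zero zero k≢j = ⊥-elim (k≢j refl)
≢⇒≡ᵇ-false zero (suc j) k≢j = refl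
≢⇒≡ᵇ-false (suc k) zero k≢j = refl
≢⇒≡ᵇ-false (suc k) (suc j) k≢j = ≢⇒≡ᵇ-false k j (λ e → k≢j (cong suc e))

update-eq : ∀ {m} (c : Chain m) j X → update c j X j ≡ X
update-eq c j X rewrite ≡ᵇ-refl j = refl

update-ne : ∀ {m} (c : Chain m) j X k → k ≢ j → update c j X k ≡ c k
update-ne c j X k k≢j rewrite ≢⇒≡ᵇ-false k j k≢j = refl

data Trace {m} (sel : ℕ → List ℕ → ℕ) :
    Chain m → List (Subset m) → List ℕ → Chain m → List (Subset m) → Set where
  done : ∀ {c s} → Trace sel c s [] c s
  step : ∀ {c s i is j G c' s'} → computeJ c s ≡ i ∷ is → sel i is ≡ j →
         Trace sel (update c j (star c j)) (star c j ∷ s) G c' s' →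
         Trace sel c s (j ∷ G) c' s'

_++ᵀ_ : ∀ {m sel c s G c₁ s₁ H c₂ s₂} →
  Trace {m} sel c s G c₁ s₁ → Trace sel c₁ s₁ H c₂ s₂ → Trace sel c s (G ++ H) c₂ s₂
done ++ᵀ t = t
step eJ eSel t ++ᵀ u = step eJ eSel (t ++ᵀ u)

run-trace : ∀ {m} sel {c s G c' s'} → Trace {m} sel c s G c' s' → ∀ n →
  run sel (length G + n) c s (computeJ c s) ≡ Maybe.map (G ++_) (run sel n c' s' (computeJ c' s'))
run-trace sel done n = sym (map-id _)
run-trace sel {c} {s} {c' = c'} {s'} (step {i = i} {is} {j} {G} eJ eSel t) n
  with computeJ c s | eJ
... | .(i ∷ is) | refl with sel i is | eSel
... | .j | refl rewrite run-trace sel t n = map-map (run sel n c' s' (computeJ c' s'))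
  where
  map-map : ∀ x → Maybe.map (j ∷_) (Maybe.map (G ++_) x) ≡ Maybe.map (λ y → j ∷ G ++ y) x
  map-map (just x) = refl
  map-map Maybe.nothing = refl

Index : ℕ → ℕ → Set
Index m i = 1 ≤ i × i < m

∈-indices⁺ : ∀ {m i} → Index m i → i ∈ˡ indices m
∈-indices⁺ {suc m} {suc i} (_ , s≤s i<m) = ∈-map⁺ suc (∈-upTo⁺ i<m)

∈-indices⁻ : ∀ {m i} → i ∈ˡ indices m → Index m i
∈-indices⁻ {suc m} p with ∈-map⁻ suc p
... | _ , q , refl = s≤s z≤n , s≤s (∈-upTo⁻ q)

∈-J⁺ : ∀ {m} {c : Chain m} {s i} → Index m i → ¬ (star c i ∈ˡ s) → i ∈ˡ computeJ c s
∈-J⁺ {c = c} {s} ix unseen = ∈-filter⁺ (λ i → ¬? (any? (star c i ≟ₛ_) s)) (∈-indices⁺ ix) unseen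

∈-J⁻ : ∀ {m} {c : Chain m} {s i} → i ∈ˡ computeJ c s → Index m i × ¬ (star c i ∈ˡ s)
∈-J⁻ {c = c} {s} p with ∈-filter⁻ (λ i → ¬? (any? (star c i ≟ₛ_) s)) p
... | i∈ , unseen = ∈-indices⁻ i∈ , unseen

J-empty : ∀ {m} {c : Chain m} {s} → (∀ i → Index m i → star c i ∈ˡ s) → computeJ c s ≡ []
J-empty {c = c} {s} allSeen = filter-none (λ i → ¬? (any? (star c i ≟ₛ_) s))
  (All.tabulate (λ p unseen → unseen (allSeen _ (∈-indices⁻ p))))

J-full : ∀ {m} {c : Chain m} {s} → (∀ i → Index m i → ¬ (star c i ∈ˡ s)) → computeJ c s ≡ indices m
J-full {c = c} {s} noneSeen = filter-all (λ i → ¬? (any? (star c i ≟ₛ_) s))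
  (All.tabulate (λ p → noneSeen _ (∈-indices⁻ p)))

maxSel-ub : ∀ {x} i is → x ∈ˡ (i ∷ is) → x ≤ maxSel i is
maxSel-ub i [] (here refl) = ≤-refl
maxSel-ub i (y ∷ is) (here refl) = ≤-trans (maxSel-ub i is (here refl)) (m≤n⊔m y _)
maxSel-ub i (y ∷ is) (there (here refl)) = m≤m⊔n y _
maxSel-ub i (y ∷ is) (there (there p)) = ≤-trans (maxSel-ub i is (there p)) (m≤n⊔m y _)

maxSel-lub : ∀ {j} i is → (∀ {x} → x ∈ˡ (i ∷ is) → x ≤ j) → maxSel i is ≤ j
maxSel-lub i [] ub = ub (here refl)
maxSel-lub i (y ∷ is) ub = ⊔-lub (ub (there (here refl)))
  (maxSel-lub i is λ { (here e) → ub (here e) ; (there p) → ub (there (there p)) })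

minSel-lb : ∀ {x} i is → x ∈ˡ (i ∷ is) → minSel i is ≤ x
minSel-lb i [] (here refl) = ≤-refl
minSel-lb i (y ∷ is) (here refl) = ≤-trans (m⊓n≤n y _) (minSel-lb i is (here refl))
minSel-lb i (y ∷ is) (there (here refl)) = m⊓n≤m y _
minSel-lb i (y ∷ is) (there (there p)) = ≤-trans (m⊓n≤n y _) (minSel-lb i is (there p))

minSel-glb : ∀ {j} i is → (∀ {x} → x ∈ˡ (i ∷ is) → j ≤ x) → j ≤ minSel i is
minSel-glb i [] lb = lb (here refl)
minSel-glb i (y ∷ is) lb = ⊓-glb (lb (there (here refl)))
  (minSel-glb i is λ { (here e) → lb (here e) ; (there p) → lb (there (there p)) })

greedy-step : ∀ {m} {c : Chain m} {s j G c' s'} → Index m j → ¬ (star c j ∈ˡ s) →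
  (∀ i → j < i → i < m → star c i ∈ˡ s) →
  Trace maxSel (update c j (star c j)) (star c j ∷ s) G c' s' → Trace maxSel c s (j ∷ G) c' s'
greedy-step {c = c} {s} {j} ix unseen seenAbove t with computeJ c s in eJ | ∈-J⁺ {c = c} {s} ix unseen
... | i ∷ is | j∈J = step eJ (≤-antisym (maxSel-lub i is below) (maxSel-ub i is j∈J)) t
  where
  below : ∀ {x} → x ∈ˡ (i ∷ is) → x ≤ j
  below p with ∈-J⁻ {c = c} {s} (subst (_ ∈ˡ_) (sym eJ) p)
  ... | (_ , x<m) , unseenX = ≮⇒≥ λ j<x → unseenX (seenAbove _ j<x x<m)

humble-step : ∀ {m} {c : Chain m} {s j G c' s'} → Index m j → ¬ (star c j ∈ˡ s) →
  (∀ i → 1 ≤ i → i < j → star c i ∈ˡ s) →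
  Trace minSel (update c j (star c j)) (star c j ∷ s) G c' s' → Trace minSel c s (j ∷ G) c' s'
humble-step {c = c} {s} {j} ix unseen seenBelow t with computeJ c s in eJ | ∈-J⁺ {c = c} {s} ix unseen
... | i ∷ is | j∈J = step eJ (≤-antisym (minSel-lb i is j∈J) (minSel-glb i is above)) t
  where
  above : ∀ {x} → x ∈ˡ (i ∷ is) → j ≤ x
  above p with ∈-J⁻ {c = c} {s} (subst (_ ∈ˡ_) (sym eJ) p)
  ... | (1≤x , _) , unseenX = ≮⇒≥ λ x<j → unseenX (seenBelow _ 1≤x x<j)

record _⋖_ {m} (A B : Subset m) : Set where
  constructor cover
  field
    ⊆-cover : A ⊆ B
    new : Fin m
    new∈ : new ∈ B
    new∉ : new ∉ A
    new-unique : ∀ {z} → z ∈ B → z ∉ A → z ≡ new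
open _⋖_ public

⊆-or-witness : ∀ {m} (X Z : Subset m) → X ⊆ Z ⊎ ∃ λ z → z ∈ X × z ∉ Z
⊆-or-witness X Z with Fin.any? (λ z → z ∈? X ×-dec ¬? (z ∈? Z))
... | yes (z , z∈X , z∉Z) = inj₂ (z , z∈X , z∉Z)
... | no none = inj₁ λ {z} z∈X → case (z ∈? Z) z∈X
  where
  case : ∀ {z} → Dec (z ∈ Z) → z ∈ X → z ∈ Z
  case (yes z∈Z) _ = z∈Z
  case (no z∉Z) z∈X = ⊥-elim (none (_ , z∈X , z∉Z))

⋖-squeeze : ∀ {m} {A B X : Subset m} (o : A ⋖ B) → A ⊆ X → new o ∈ X → B ⊆ X
⋖-squeeze {A = A} o A⊆X new∈X {x} x∈B with x ∈? A
... | yes x∈A = A⊆X x∈A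
... | no x∉A = subst (_∈ _) (sym (new-unique o x∈B x∉A)) new∈X

module Exchange {m} {A C D : Subset m} (o₁ : A ⋖ C) (o₂ : C ⋖ D) where
  S : Subset m
  S = A ∪ (D ∩ ∁ C)
  x = new o₁
  y = new o₂

  ∈S⁻ : ∀ {z} → z ∈ S → z ∈ A ⊎ z ≡ y
  ∈S⁻ p with x∈p∪q⁻ A (D ∩ ∁ C) p
  ... | inj₁ z∈A = inj₁ z∈A
  ... | inj₂ q with x∈p∩q⁻ D (∁ C) q
  ... | z∈D , z∈∁C = inj₂ (new-unique o₂ z∈D (x∈∁p⇒x∉p z∈∁C))

  y∈S : y ∈ S
  y∈S = x∈p∪q⁺ (inj₂ (x∈p∩q⁺ (new∈ o₂ , x∉p⇒x∈∁p (new∉ o₂))))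

  A⊆S : A ⊆ S
  A⊆S p = x∈p∪q⁺ (inj₁ p)

  y∉A : y ∉ A
  y∉A p = new∉ o₂ (⊆-cover o₁ p)

  x∉S : x ∉ S
  x∉S p with ∈S⁻ p
  ... | inj₁ x∈A = new∉ o₁ x∈A
  ... | inj₂ x≡y = new∉ o₂ (subst (_∈ C) x≡y (new∈ o₁))

  S⊆D : S ⊆ D
  S⊆D p with ∈S⁻ p
  ... | inj₁ z∈A = ⊆-cover o₂ (⊆-cover o₁ z∈A)
  ... | inj₂ refl = new∈ o₂

  A⋖S : A ⋖ S
  A⋖S = cover A⊆S y y∈S y∉A unique
    where
    unique : ∀ {z} → z ∈ S → z ∉ A → z ≡ y
    unique z∈S z∉A with ∈S⁻ z∈S
    ... | inj₁ z∈A = ⊥-elim (z∉A z∈A)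
    ... | inj₂ z≡y = z≡y

  S⋖D : S ⋖ D
  S⋖D = cover S⊆D x (⊆-cover o₂ (new∈ o₁)) x∉S unique
    where
    unique : ∀ {z} → z ∈ D → z ∉ S → z ≡ x
    unique {z} z∈D z∉S with z ∈? C | z ∈? A
    ... | yes z∈C | yes z∈A = ⊥-elim (z∉S (A⊆S z∈A))
    ... | yes z∈C | no z∉A = new-unique o₁ z∈C z∉A
    ... | no z∉C | _ = ⊥-elim (z∉S (x∈p∪q⁺ (inj₂ (x∈p∩q⁺ (z∈D , x∉p⇒x∈∁p z∉C)))))

Saturated : ∀ {m} → Chain m → ℕ → ℕ → Set
Saturated c a b = ∀ k → a ≤ k → k < b → c k ⋖ c (suc k)

Agree : ∀ {m} → Chain m → Chain m → ℕ → ℕ → Set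
Agree c c' a b = ∀ t → (t ≤ a ⊎ b ≤ t) → c' t ≡ c t

Inner : ∀ {m} → Subset m → Subset m → Subset m → Set
Inner lo hi X = lo ⊆ X × X ⊆ hi × ∃ λ z → z ∈ X × z ∉ lo

Extends : ∀ {m} → Subset m → Subset m → List (Subset m) → List (Subset m) → Set
Extends lo hi s s' = (∀ {X} → X ∈ˡ s → X ∈ˡ s') × (∀ {X} → X ∈ˡ s' → X ∈ˡ s ⊎ Inner lo hi X)

saturated-mono : ∀ {m} {c : Chain m} {a b k} l → Saturated c a b → a ≤ k → k ≤ l → l ≤ b → c k ⊆ c l
saturated-mono {k = k} l sat a≤k k≤l l≤b with m≤n⇒m<n∨m≡n k≤l
... | inj₂ refl = λ p → p
saturated-mono (suc l) sat a≤k k≤l l≤b | inj₁ (s≤s k≤l') =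
  λ p → ⊆-cover (sat l (≤-trans a≤k k≤l') l≤b) (saturated-mono l sat a≤k k≤l' (≤-trans (n≤1+n l) l≤b) p)

saturated-sub : ∀ {m} {c : Chain m} {a b a' b'} → Saturated c a b → a ≤ a' → b' ≤ b → Saturated c a' b'
saturated-sub sat a≤a' b'≤b k a'≤k k<b' = sat k (≤-trans a≤a' a'≤k) (<-≤-trans k<b' b'≤b)

⋖-transport : ∀ {m} (c c' : Chain m) k → c' k ≡ c k → c' (suc k) ≡ c (suc k) →
  c k ⋖ c (suc k) → c' k ⋖ c' (suc k)
⋖-transport c c' k e₁ e₂ o rewrite e₁ | e₂ = o

saturated-top : ∀ {m} (c : Chain m) a b → Saturated c a b → c b ⋖ c (suc b) → Saturated c a (suc b)
saturated-top c a b sat o k a≤k k≤b with k ≟ b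
... | yes refl = o
... | no k≢b = sat k a≤k (≤∧≢⇒< (≤-pred k≤b) k≢b)

saturated-bot : ∀ {m} (c : Chain m) a b → Saturated c (suc a) b → c a ⋖ c (suc a) → Saturated c a b
saturated-bot c a b sat o k a≤k k<b with k ≟ a
... | yes refl = o
... | no k≢a = sat k (≤∧≢⇒< a≤k (λ e → k≢a (sym e))) k<b

Agree-refl : ∀ {m} {c : Chain m} {a b} → Agree c c a b
Agree-refl t _ = refl

Agree-trans : ∀ {m} {c₁ c₂ c₃ : Chain m} {a b} → Agree c₁ c₂ a b → Agree c₂ c₃ a b → Agree c₁ c₃ a b
Agree-trans g h t p = trans (h t p) (g t p)

Agree-update : ∀ {m} {c : Chain m} {a b} p X → a < p → p < b → Agree c (update c p X) a b
Agree-update {c = c} p X a<p p<b t (inj₁ t≤a) = update-ne c p X t (<⇒≢ (≤-<-trans t≤a a<p))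
Agree-update {c = c} p X a<p p<b t (inj₂ b≤t) = update-ne c p X t (λ e → <⇒≢ (<-≤-trans p<b b≤t) (sym e))

Agree-widen : ∀ {m} {c c' : Chain m} {a b a' b'} → Agree c c' a' b' → a ≤ a' → b' ≤ b → Agree c c' a b
Agree-widen g a≤a' b'≤b t (inj₁ t≤a) = g t (inj₁ (≤-trans t≤a a≤a'))
Agree-widen g a≤a' b'≤b t (inj₂ b≤t) = g t (inj₂ (≤-trans b'≤b b≤t))

Inner-agree : ∀ {m} {c c' : Chain m} {a b X} → Agree c c' a b → Inner (c' a) (c' b) X → Inner (c a) (c b) X
Inner-agree {a = a} {b} g inn rewrite g a (inj₁ ≤-refl) | g b (inj₂ ≤-refl) = inn

Inner-≡ : ∀ {m} {lo hi lo' hi' X : Subset m} → lo ≡ lo' → hi ≡ hi' → Inner lo hi X → Inner lo' hi' X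
Inner-≡ refl refl inn = inn

Inner-⋖ : ∀ {m} {A B X : Subset m} (o : A ⋖ B) → Inner A B X → X ≡ B
Inner-⋖ o (A⊆X , X⊆B , z , z∈X , z∉A) =
  ⊆-antisym X⊆B (⋖-squeeze o A⊆X (subst (_∈ _) (new-unique o (X⊆B z∈X) z∉A) z∈X))

Extends-refl : ∀ {m} {lo hi : Subset m} {s} → Extends lo hi s s
Extends-refl = (λ x → x) , inj₁

Extends-trans : ∀ {m} {lo hi : Subset m} {s₁ s₂ s₃} → Extends lo hi s₁ s₂ → Extends lo hi s₂ s₃ → Extends lo hi s₁ s₃
Extends-trans (f₁ , g₁) (f₂ , g₂) = (λ x → f₂ (f₁ x)) , back
  where
  back : ∀ {X} → X ∈ˡ _ → X ∈ˡ _ ⊎ Inner _ _ X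
  back q with g₂ q
  ... | inj₂ inn = inj₂ inn
  ... | inj₁ x = g₁ x

Extends-cons : ∀ {m} {lo hi S : Subset m} {s s'} → Inner lo hi S → Extends lo hi (S ∷ s) s' → Extends lo hi s s'
Extends-cons inn (f , g) = (λ x → f (there x)) , back
  where
  back : ∀ {X} → X ∈ˡ _ → X ∈ˡ _ ⊎ Inner _ _ X
  back q with g q
  ... | inj₂ inn' = inj₂ inn'
  ... | inj₁ (there x) = inj₁ x
  ... | inj₁ (here refl) = inj₂ inn

Extends-weaken : ∀ {m} {lo hi lo' hi' : Subset m} {s s'} →
  (∀ {X} → Inner lo hi X → Inner lo' hi' X) → Extends lo hi s s' → Extends lo' hi' s s'
Extends-weaken f (g , h) = g , λ q → map₂ f (h q)

star-cong : ∀ {m} {c c' : Chain m} i → c' (i ∸ 1) ≡ c (i ∸ 1) → c' i ≡ c i → c' (suc i) ≡ c (suc i) →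
  star c' i ≡ star c i
star-cong i e₁ e₂ e₃ rewrite e₁ | e₂ | e₃ = refl

module AlterAt {m} {c : Chain m} {a b} (sat : Saturated c a b) (k : ℕ) (a≤k : a ≤ k) (k+2≤b : suc (suc k) ≤ b) where
  lower : c k ⋖ c (suc k)
  lower = sat k a≤k (≤-trans (n≤1+n _) k+2≤b)
  upper : c (suc k) ⋖ c (suc (suc k))
  upper = sat (suc k) (≤-trans a≤k (n≤1+n k)) k+2≤b
  open Exchange lower upper public

  ck⊆ : c a ⊆ c k
  ck⊆ = saturated-mono k sat ≤-refl a≤k (≤-trans (n≤1+n _) (≤-trans (n≤1+n _) k+2≤b))

  inner : Inner (c a) (c b) (star c (suc k))
  inner = (λ p → A⊆S (ck⊆ p)) ,
          (λ p → saturated-mono b sat (≤-trans a≤k (≤-trans (n≤1+n k) (n≤1+n _))) k+2≤b ≤-refl (S⊆D p)) ,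
          y , y∈S , (λ p → y∉A (ck⊆ p))

  altered : Chain m
  altered = update c (suc k) S

  altered-saturated : Saturated altered a b
  altered-saturated t a≤t t<b with t ≟ k | t ≟ suc k
  ... | yes refl | _ rewrite update-eq c (suc k) S | update-ne c (suc k) S k (λ e → 1+n≢n (sym e)) = A⋖S
  ... | no _ | yes refl rewrite update-eq c (suc k) S | update-ne c (suc k) S (suc (suc k)) 1+n≢n = S⋖D
  ... | no t≢k | no t≢k+1 rewrite update-ne c (suc k) S t t≢k+1 | update-ne c (suc k) S (suc t) (λ e → t≢k (suc-injective e)) =
    sat t a≤t t<b

  off-chain : ∀ t → a ≤ t → t ≤ b → S ≢ c t
  off-chain t a≤t t≤b S≡ct with ≤-total t (suc k)
  ... | inj₁ t≤k+1 = new∉ upper (saturated-mono (suc k) sat a≤t t≤k+1 (≤-trans (n≤1+n _) k+2≤b) (subst (_ ∈_) S≡ct y∈S))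
  ... | inj₂ k+1≤t = x∉S (subst (_ ∈_) (sym S≡ct) (saturated-mono t sat (≤-trans a≤k (n≤1+n _)) k+1≤t t≤b (new∈ lower)))

OnlyChainSeen : ∀ {m} → Chain m → ℕ → ℕ → List (Subset m) → Set
OnlyChainSeen c a b s = ∀ {X} → Inner (c a) (c b) X → X ∈ˡ s → ∃ λ t → a < t × t ≤ b × X ≡ c t

ChainSeen : ∀ {m} → Chain m → ℕ → ℕ → List (Subset m) → Set
ChainSeen c a b s = ∀ t → a < t → t ≤ b → c t ∈ˡ s

record Visit {m} (sel : ℕ → List ℕ → ℕ) (c : Chain m) (s : List (Subset m)) (a b : ℕ) (G : List ℕ) : Set where
  field
    c' : Chain m
    s' : List (Subset m)
    trace : Trace sel c s G c' s'
    extends : Extends (c a) (c b) s s'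
    all-seen : ∀ {X} → Inner (c a) (c b) X → X ∈ˡ s'
    agree : Agree c c' a b
    saturated : Saturated c' a b

visit-base : ∀ {m} {sel} {c : Chain m} {s a} → Saturated c a (suc a) → ChainSeen c a (suc a) s → Visit sel c s a (suc a) []
visit-base {c = c} {s} {a} sat seen = record
  { c' = c ; s' = s ; trace = done ; extends = Extends-refl
  ; all-seen = λ inn → subst (_∈ˡ s) (sym (Inner-⋖ (sat a ≤-refl ≤-refl) inn)) (seen (suc a) ≤-refl ≤-refl)
  ; agree = Agree-refl ; saturated = sat }

record Swept {m} (sel : ℕ → List ℕ → ℕ) (Inv : Chain m → List (Subset m) → Set)
             (lo hi : Subset m) (c : Chain m) (s : List (Subset m)) (G : List ℕ) : Set where
  field
    c' : Chain m
    s' : List (Subset m)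
    trace : Trace sel c s G c' s'
    extends : Extends lo hi s s'
    invariant : Inv c' s'

ascending : ℕ → ℕ → List ℕ
ascending k zero = []
ascending k (suc n) = k ∷ ascending (suc k) n

greedySeq : ℕ → ℕ → List ℕ
greedySeq a zero = []
greedySeq a (suc e) = greedySeq (suc a) e ++ (ascending (suc a) (suc e) ++ greedySeq a e)

module _ {m : ℕ} where

  SeenAtTop : Chain m → ℕ → ℕ → List (Subset m) → Set
  SeenAtTop c a b s = b < m → ∀ {Y} → c a ⊆ Y → Y ⊆ c b → (Y ∪ (c (suc b) ∩ ∁ (c b))) ∈ˡ s

  SeenAbove : Chain m → ℕ → List (Subset m) → Set
  SeenAbove c b s = ∀ i → b < i → i < m → star c i ∈ˡ s

  star-top-seen : ∀ {c₀ c : Chain m} {a b s} → a < b → b < m → Agree c₀ c a b → Saturated c a b →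
    SeenAtTop c₀ a b s → star c b ∈ˡ s
  star-top-seen {c₀} {c} {a} {suc b} (s≤s a≤b) b<m g sat top
    rewrite g (suc (suc b)) (inj₂ (n≤1+n _)) | sym (g (suc b) (inj₂ ≤-refl)) =
    top b<m (λ p → saturated-mono b sat ≤-refl a≤b (n≤1+n _) (subst (_ ∈_) (sym (g a (inj₁ ≤-refl))) p))
            (⊆-cover (sat b a≤b ≤-refl))

  star-above-seen : ∀ {c₀ c : Chain m} {a b s} i → b < i → Agree c₀ c a b → star c₀ i ∈ˡ s → star c i ∈ˡ s
  star-above-seen {c₀} {c} (suc i) (s≤s b≤i) g =
    subst (_∈ˡ _) (sym (star-cong {c = c₀} {c' = c} (suc i) (g i (inj₂ b≤i))
      (g (suc i) (inj₂ (≤-trans b≤i (n≤1+n _)))) (g (suc (suc i)) (inj₂ (≤-trans b≤i (≤-trans (n≤1+n _) (n≤1+n _)))))))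

  -- The invariant of the upward sweep of the element w through [a,b],
  -- relative to the chain c₀ at the start of the sweep: w is now added at
  -- position p, every inner set containing w has been seen, and the seen
  -- inner sets avoiding w are exactly c (a+1), …, c (p-1).
  record SweepUp (c₀ : Chain m) (a b : ℕ) (w : Fin m) (p : ℕ) (c : Chain m) (s : List (Subset m)) : Set where
    field
      agree : Agree c₀ c a b
      saturated : Saturated c a b
      w∈ : ∀ t → p ≤ t → t ≤ b → w ∈ c t
      w∉ : ∀ t → a ≤ t → t < p → w ∉ c t
      seen-w : ∀ {X} → Inner (c₀ a) (c₀ b) X → w ∈ X → X ∈ˡ s
      seen-¬w⇒ : ∀ {X} → Inner (c₀ a) (c₀ b) X → w ∉ X → X ∈ˡ s → ∃ λ t → a < t × t < p × X ≡ c t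
      seen-¬w⇐ : ∀ t → a < t → t < p → c t ∈ˡ s
      seen-top : SeenAtTop c₀ a b s
      seen-above : SeenAbove c₀ b s

  module SweepUpStep {c₀ a b w k c s} (inv : SweepUp c₀ a b w (suc k) c s)
                     (a≤k : a ≤ k) (k+2≤b : suc (suc k) ≤ b) (b≤m : b ≤ m) where
    open SweepUp inv
    open AlterAt saturated k a≤k k+2≤b public

    inner₀ : Inner (c₀ a) (c₀ b) S
    inner₀ = Inner-agree agree inner

    w∉S : w ∉ S
    w∉S p with ∈S⁻ p
    ... | inj₁ w∈ck = w∉ k a≤k ≤-refl w∈ck
    ... | inj₂ w≡y = new∉ upper (subst (_∈ c (suc k)) w≡y (w∈ (suc k) ≤-refl (≤-trans (n≤1+n _) k+2≤b)))

    unseen : ¬ (S ∈ˡ s)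
    unseen S∈s with seen-¬w⇒ inner₀ w∉S S∈s
    ... | t , a<t , t<p , S≡ct = off-chain t (<⇒≤ a<t) (≤-trans (<⇒≤ t<p) (≤-trans (n≤1+n _) k+2≤b)) S≡ct

    seen-beyond : ∀ i → suc k < i → i < m → star c i ∈ˡ s
    seen-beyond i k+1<i i<m with <-cmp i b
    seen-beyond (suc i) (s≤s k<i) i<m | tri< i+1<b _ _ =
      seen-w (Inner-agree agree (AlterAt.inner saturated i a≤i i+1<b))
             (AlterAt.A⊆S saturated i a≤i i+1<b (w∈ i k<i (≤-trans (n≤1+n _) (≤-trans (n≤1+n _) i+1<b))))
      where a≤i = ≤-trans a≤k (≤-trans (n≤1+n _) k<i)
    ... | tri≈ _ refl _ = star-top-seen (<-≤-trans (s≤s a≤k) (≤-trans (n≤1+n _) k+2≤b)) i<m agree saturated seen-top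
    ... | tri> _ _ b<i = star-above-seen i b<i agree (seen-above i b<i i<m)

    next : SweepUp c₀ a b w (suc (suc k)) altered (S ∷ s)
    next = record
      { agree = Agree-trans agree (Agree-update (suc k) S (s≤s a≤k) k+2≤b)
      ; saturated = altered-saturated
      ; w∈ = w∈'
      ; w∉ = w∉'
      ; seen-w = λ inn w∈X → there (seen-w inn w∈X)
      ; seen-¬w⇒ = seen⇒
      ; seen-¬w⇐ = seen⇐
      ; seen-top = λ b<m A⊆Y Y⊆B → there (seen-top b<m A⊆Y Y⊆B)
      ; seen-above = λ i b<i i<m → there (seen-above i b<i i<m) }
      where
      w∈' : ∀ t → suc (suc k) ≤ t → t ≤ b → w ∈ altered t
      w∈' t k+2≤t t≤b rewrite update-ne c (suc k) S t (λ e → <⇒≢ k+2≤t (sym e)) = w∈ t (≤-trans (n≤1+n _) k+2≤t) t≤b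
      w∉' : ∀ t → a ≤ t → t < suc (suc k) → w ∉ altered t
      w∉' t a≤t t<k+2 with t ≟ suc k
      ... | yes refl rewrite update-eq c (suc k) S = w∉S
      ... | no t≢k+1 rewrite update-ne c (suc k) S t t≢k+1 = w∉ t a≤t (≤∧≢⇒< (≤-pred t<k+2) t≢k+1)
      seen⇒ : ∀ {X} → Inner (c₀ a) (c₀ b) X → w ∉ X → X ∈ˡ (S ∷ s) → ∃ λ t → a < t × t < suc (suc k) × X ≡ altered t
      seen⇒ inn w∉X (here X≡S) = suc k , s≤s a≤k , ≤-refl , trans X≡S (sym (update-eq c (suc k) S))
      seen⇒ inn w∉X (there X∈s) with seen-¬w⇒ inn w∉X X∈s
      ... | t , a<t , t<p , X≡ct = t , a<t , m<n⇒m<1+n t<p , trans X≡ct (sym (update-ne c (suc k) S t (<⇒≢ t<p)))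
      seen⇐ : ∀ t → a < t → t < suc (suc k) → altered t ∈ˡ (S ∷ s)
      seen⇐ t a<t t<k+2 with t ≟ suc k
      ... | yes refl = here (update-eq c (suc k) S)
      ... | no t≢k+1 rewrite update-ne c (suc k) S t t≢k+1 = there (seen-¬w⇐ t a<t (≤∧≢⇒< (≤-pred t<k+2) t≢k+1))

    index : Index m (suc k)
    index = s≤s z≤n , ≤-trans k+2≤b b≤m

  abstract
   sweep-up : ∀ r {c₀ a b w p c s} → r + p ≡ b → a < p → b ≤ m → SweepUp c₀ a b w p c s →
     Swept maxSel (SweepUp c₀ a b w b) (c₀ a) (c₀ b) c s (ascending p r)
   sweep-up zero refl _ _ inv = record { trace = done ; extends = Extends-refl ; invariant = inv }
   sweep-up (suc r) {c₀} {a} {b} {w} {suc k} {c} {s} eq (s≤s a≤k) b≤m inv =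
     record { c' = c' ; s' = s' ; trace = greedy-step index unseen seen-beyond trace
            ; extends = Extends-cons inner₀ extends ; invariant = invariant }
     where
     k+2≤b : suc (suc k) ≤ b
     k+2≤b = subst (suc (suc k) ≤_) eq (s≤s (m≤n+m (suc k) r))
     open SweepUpStep inv a≤k k+2≤b b≤m
     rest : Swept maxSel (SweepUp c₀ a b w b) (c₀ a) (c₀ b) altered (S ∷ s) (ascending (suc (suc k)) r)
     rest = sweep-up r (trans (+-suc r (suc k)) eq) (s≤s (≤-trans a≤k (n≤1+n _))) b≤m next
     open Swept rest

  GreedyVisits : ℕ → Set
  GreedyVisits e = ∀ {a b} {c : Chain m} {s} → b ≡ suc (e + a) → b ≤ m → Saturated c a b →
    OnlyChainSeen c a b s → ChainSeen c a b s → SeenAtTop c a b s → SeenAbove c b s →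
    Visit maxSel c s a b (greedySeq a e)

  -- The induction step on [a,b] with b = a+e+2: visit [a+1,b], sweep the
  -- element w added at a to the top, visit [a,b-1] of the new chain.
  module GreedyStep (e : ℕ) (IH : GreedyVisits e) {a} {c : Chain m} {s}
    (b≤m : suc (suc (e + a)) ≤ m) (sat : Saturated c a (suc (suc (e + a))))
    (only : OnlyChainSeen c a (suc (suc (e + a))) s) (seen : ChainSeen c a (suc (suc (e + a))) s)
    (top : SeenAtTop c a (suc (suc (e + a))) s) (above : SeenAbove c (suc (suc (e + a))) s) where

    b b' : ℕ
    b = suc (suc (e + a))
    b' = suc (e + a)

    a≤b' : a ≤ b'
    a≤b' = ≤-trans (m≤n+m a e) (n≤1+n _)

    a<b : a < b
    a<b = s≤s a≤b'

    bottom : c a ⋖ c (suc a)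
    bottom = sat a ≤-refl a<b

    w : Fin m
    w = new bottom

    -- Phase 1: the inner sets of [a+1,b] are those of [a,b] containing w.
    inner-up : ∀ {X} → Inner (c (suc a)) (c b) X → Inner (c a) (c b) X
    inner-up (A⊆X , X⊆B , z , z∈X , z∉A) = (λ p → A⊆X (⊆-cover bottom p)) , X⊆B , z , z∈X , (λ p → z∉A (⊆-cover bottom p))

    only₁ : OnlyChainSeen c (suc a) b s
    only₁ inn@(_ , _ , z , z∈X , z∉A) X∈s with only (inner-up inn) X∈s
    ... | t , a<t , t≤b , X≡ct with t ≟ suc a
    ... | yes refl = ⊥-elim (z∉A (subst (z ∈_) X≡ct z∈X))
    ... | no t≢a+1 = t , ≤∧≢⇒< a<t (λ e → t≢a+1 (sym e)) , t≤b , X≡ct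

    module R₁ = Visit (IH (cong suc (sym (+-suc e a))) b≤m (saturated-sub sat (n≤1+n a) ≤-refl) only₁
                         (λ t a+1<t t≤b → seen t (<-trans (n<1+n a) a+1<t) t≤b)
                         (λ b<m A⊆Y Y⊆B → top b<m (λ p → A⊆Y (⊆-cover bottom p)) Y⊆B) above)
    c₁ : Chain m
    c₁ = R₁.c'
    s₁ : List (Subset m)
    s₁ = R₁.s'

    c₁a≡ : c₁ a ≡ c a
    c₁a≡ = R₁.agree a (inj₁ (n≤1+n a))
    c₁a+1≡ : c₁ (suc a) ≡ c (suc a)
    c₁a+1≡ = R₁.agree (suc a) (inj₁ ≤-refl)
    c₁b≡ : c₁ b ≡ c b
    c₁b≡ = R₁.agree b (inj₂ ≤-refl)

    sat₁ : Saturated c₁ a b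
    sat₁ = saturated-bot c₁ a b R₁.saturated (⋖-transport c c₁ a c₁a≡ c₁a+1≡ bottom)

    seen-w₁ : ∀ {X} → Inner (c a) (c b) X → w ∈ X → X ∈ˡ s₁
    seen-w₁ {X} (A⊆X , X⊆B , _) w∈X with ⊆-or-witness X (c (suc a))
    ... | inj₁ X⊆A' = proj₁ R₁.extends (subst (_∈ˡ s) (sym (⊆-antisym X⊆A' (⋖-squeeze bottom A⊆X w∈X))) (seen (suc a) ≤-refl a<b))
    ... | inj₂ (z , z∈X , z∉A') = R₁.all-seen (⋖-squeeze bottom A⊆X w∈X , X⊆B , z , z∈X , z∉A')

    unseen-¬w₁ : ∀ {X} → Inner (c a) (c b) X → w ∉ X → ¬ (X ∈ˡ s₁)
    unseen-¬w₁ inn w∉X X∈s₁ with proj₂ R₁.extends X∈s₁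
    ... | inj₁ X∈s with only inn X∈s
    ... | t , a<t , t≤b , X≡ct = w∉X (subst (w ∈_) (sym X≡ct) (saturated-mono t sat (n≤1+n a) a<t t≤b (new∈ bottom)))
    unseen-¬w₁ inn w∉X X∈s₁ | inj₂ inn' = w∉X (proj₁ inn' (new∈ bottom))

    top₁ : SeenAtTop c₁ a b s₁
    top₁ b<m {Y} A⊆Y Y⊆B rewrite R₁.agree (suc b) (inj₂ (n≤1+n _)) | c₁b≡ =
      proj₁ R₁.extends (top b<m (subst (_⊆ Y) c₁a≡ A⊆Y) Y⊆B)

    start : SweepUp c₁ a b w (suc a) c₁ s₁
    start = record
      { agree = Agree-refl
      ; saturated = sat₁
      ; w∈ = λ t a+1≤t t≤b → saturated-mono t sat₁ (n≤1+n a) a+1≤t t≤b (subst (w ∈_) (sym c₁a+1≡) (new∈ bottom))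
      ; w∉ = λ { t a≤t (s≤s t≤a) → subst (λ j → w ∉ c₁ j) (≤-antisym a≤t t≤a) (λ p → new∉ bottom (subst (w ∈_) c₁a≡ p)) }
      ; seen-w = λ inn → seen-w₁ (Inner-≡ c₁a≡ c₁b≡ inn)
      ; seen-¬w⇒ = λ inn w∉X X∈s₁ → ⊥-elim (unseen-¬w₁ (Inner-≡ c₁a≡ c₁b≡ inn) w∉X X∈s₁)
      ; seen-¬w⇐ = λ t a<t t<a+1 → ⊥-elim (<-irrefl refl (<-≤-trans a<t (≤-pred t<a+1)))
      ; seen-top = top₁
      ; seen-above = λ i b<i i<m → star-above-seen i b<i R₁.agree (proj₁ R₁.extends (above i b<i i<m)) }

    module R₂ = Swept (sweep-up (suc e) (cong suc (+-suc e a)) (n<1+n a) b≤m start)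
    c₂ : Chain m
    c₂ = R₂.c'
    s₂ : List (Subset m)
    s₂ = R₂.s'
    open SweepUp R₂.invariant

    c₂a≡ : c₂ a ≡ c₁ a
    c₂a≡ = agree a (inj₁ ≤-refl)
    c₂b≡ : c₂ b ≡ c₁ b
    c₂b≡ = agree b (inj₂ ≤-refl)
    top₂ : c₂ b' ⋖ c₂ b
    top₂ = saturated b' a≤b' ≤-refl

    -- Phase 3: the inner sets of [a,b-1] are those of [a,b] avoiding w.
    inner-down : ∀ {X} → Inner (c₂ a) (c₂ b') X → Inner (c₁ a) (c₁ b) X
    inner-down (A⊆X , X⊆B , z , z∈X , z∉A) =
      (λ p → A⊆X (subst (_ ∈_) (sym c₂a≡) p)) , (λ p → subst (_ ∈_) c₂b≡ (⊆-cover top₂ (X⊆B p))) ,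
      z , z∈X , (λ p → z∉A (subst (_ ∈_) (sym c₂a≡) p))

    only₂ : OnlyChainSeen c₂ a b' s₂
    only₂ inn X∈s₂ with seen-¬w⇒ (inner-down inn) (λ w∈X → w∉ b' a≤b' ≤-refl (proj₁ (proj₂ inn) w∈X)) X∈s₂
    ... | t , a<t , t<b , X≡ct = t , a<t , ≤-pred t<b , X≡ct

    top₃ : SeenAtTop c₂ a b' s₂
    top₃ _ {Y} A⊆Y Y⊆B = seen-w (A⊆Z , Z⊆B , w , w∈Z , λ p → new∉ bottom (subst (w ∈_) c₁a≡ p)) w∈Z
      where
      Z = Y ∪ (c₂ b ∩ ∁ (c₂ b'))
      w∈Z : w ∈ Z
      w∈Z = x∈p∪q⁺ (inj₂ (x∈p∩q⁺ (w∈ b ≤-refl ≤-refl , x∉p⇒x∈∁p (w∉ b' a≤b' ≤-refl))))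
      A⊆Z : c₁ a ⊆ Z
      A⊆Z p = x∈p∪q⁺ (inj₁ (A⊆Y (subst (_ ∈_) (sym c₂a≡) p)))
      Z⊆B : Z ⊆ c₁ b
      Z⊆B p with x∈p∪q⁻ Y _ p
      ... | inj₁ y = subst (_ ∈_) c₂b≡ (⊆-cover top₂ (Y⊆B y))
      ... | inj₂ d = subst (_ ∈_) c₂b≡ (proj₁ (x∈p∩q⁻ _ _ d))

    above₃ : SeenAbove c₂ b' s₂
    above₃ i b'<i i<m with i ≟ b
    ... | yes refl = star-top-seen a<b i<m agree saturated seen-top
    ... | no i≢b = star-above-seen i (≤∧≢⇒< b'<i (λ e → i≢b (sym e))) agree (seen-above i (≤∧≢⇒< b'<i (λ e → i≢b (sym e))) i<m)

    module R₃ = Visit (IH refl (≤-trans (n≤1+n _) b≤m) (saturated-sub saturated ≤-refl (n≤1+n _)) only₂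
                         (λ t a<t t≤b' → seen-¬w⇐ t a<t (s≤s t≤b')) top₃ above₃)

    -- Every inner set has been seen: with w in phase 1, without w in phase 3.
    all-seen₃ : ∀ {X} → Inner (c a) (c b) X → X ∈ˡ R₃.s'
    all-seen₃ {X} inn@(A⊆X , X⊆B , z , z∈X , z∉A) with w ∈? X
    ... | yes w∈X = proj₁ R₃.extends (proj₁ R₂.extends (seen-w₁ inn w∈X))
    ... | no w∉X = R₃.all-seen (A₂⊆X , X⊆B' , z , z∈X , λ p → z∉A (subst (_ ∈_) (trans c₂a≡ c₁a≡) p))
      where
      A₂⊆X : c₂ a ⊆ X
      A₂⊆X p = A⊆X (subst (_ ∈_) (trans c₂a≡ c₁a≡) p)
      X⊆B' : X ⊆ c₂ b'
      X⊆B' {x} x∈X with x ∈? c₂ b'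
      ... | yes x∈B' = x∈B'
      ... | no x∉B' = ⊥-elim (w∉X (subst (_∈ X) x≡w x∈X))
        where
        x≡w : x ≡ w
        x≡w = trans (new-unique top₂ (subst (_ ∈_) (sym (trans c₂b≡ c₁b≡)) (X⊆B x∈X)) x∉B')
                    (sym (new-unique top₂ (w∈ b ≤-refl ≤-refl) (w∉ b' a≤b' ≤-refl)))

    visit : Visit maxSel c s a b (greedySeq a (suc e))
    visit = record
      { c' = R₃.c' ; s' = R₃.s'
      ; trace = R₁.trace ++ᵀ (R₂.trace ++ᵀ R₃.trace)
      ; extends = Extends-trans (Extends-weaken inner-up R₁.extends)
                   (Extends-trans (Extends-weaken (Inner-≡ c₁a≡ c₁b≡) R₂.extends)
                     (Extends-weaken (λ inn → Inner-≡ c₁a≡ c₁b≡ (inner-down inn)) R₃.extends))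
      ; all-seen = all-seen₃
      ; agree = Agree-trans (Agree-widen R₁.agree (n≤1+n a) ≤-refl) (Agree-trans agree (Agree-widen R₃.agree ≤-refl (n≤1+n _)))
      ; saturated = saturated-top R₃.c' a b' R₃.saturated
                      (⋖-transport c₂ R₃.c' b' (R₃.agree b' (inj₂ ≤-refl)) (R₃.agree b (inj₂ (n≤1+n _))) top₂) }

  greedy-visits : ∀ e → GreedyVisits e
  greedy-visits zero refl _ sat _ seen _ _ = visit-base sat seen
  greedy-visits (suc e) refl b≤m sat only seen top above = GreedyStep.visit e (greedy-visits e) b≤m sat only seen top above

descending : ℕ → ℕ → List ℕ
descending a zero = []
descending a (suc n) = suc (n + a) ∷ descending a n

humbleSeq : ℕ → ℕ → List ℕ
humbleSeq a zero = []
humbleSeq a (suc e) = humbleSeq a e ++ (descending a (suc e) ++ humbleSeq (suc a) e)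

module _ {m : ℕ} where

  SeenAtBottom : Chain m → ℕ → ℕ → List (Subset m) → Set
  SeenAtBottom c a b s = 1 ≤ a → ∀ {Y} → c a ⋖ Y → Y ⊆ c b → (c (a ∸ 1) ∪ (Y ∩ ∁ (c a))) ∈ˡ s

  SeenBelow : Chain m → ℕ → List (Subset m) → Set
  SeenBelow c a s = ∀ i → 1 ≤ i → i < a → star c i ∈ˡ s

  star-bottom-seen : ∀ {c₀ c : Chain m} {a b s} → 1 ≤ a → a < b → Agree c₀ c a b → Saturated c a b →
    SeenAtBottom c₀ a b s → star c a ∈ˡ s
  star-bottom-seen {c₀} {c} {suc a} {b} 1≤a a<b g sat bottom
    rewrite g a (inj₁ (n≤1+n _)) | sym (g (suc a) (inj₁ ≤-refl)) =
    bottom 1≤a (sat (suc a) ≤-refl a<b)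
      (λ p → subst (_ ∈_) (g b (inj₂ ≤-refl)) (saturated-mono b sat (n≤1+n _) a<b ≤-refl p))

  star-below-seen : ∀ {c₀ c : Chain m} {a b s} i → i < a → Agree c₀ c a b → star c₀ i ∈ˡ s → star c i ∈ˡ s
  star-below-seen {c₀} {c} i i<a g =
    subst (_∈ˡ _) (sym (star-cong {c = c₀} {c' = c} i (g (i ∸ 1) (inj₁ (≤-trans (m∸n≤m i 1) (<⇒≤ i<a))))
      (g i (inj₁ (<⇒≤ i<a))) (g (suc i) (inj₁ i<a))))

  -- The invariant of the downward sweep of the element q through [a,b],
  -- relative to the chain c₀ at its start: q is now added at position p,
  -- every inner set avoiding q has been seen, and the seen inner sets
  -- containing q are exactly c (p+1), …, c b.
  record SweepDown (c₀ : Chain m) (a b : ℕ) (q : Fin m) (p : ℕ) (c : Chain m) (s : List (Subset m)) : Set where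
    field
      agree : Agree c₀ c a b
      saturated : Saturated c a b
      q∈ : ∀ t → p < t → t ≤ b → q ∈ c t
      q∉ : ∀ t → a ≤ t → t ≤ p → q ∉ c t
      seen-¬q : ∀ {X} → Inner (c₀ a) (c₀ b) X → q ∉ X → X ∈ˡ s
      seen-q⇒ : ∀ {X} → Inner (c₀ a) (c₀ b) X → q ∈ X → X ∈ˡ s → ∃ λ t → p < t × t ≤ b × X ≡ c t
      seen-q⇐ : ∀ t → p < t → t ≤ b → c t ∈ˡ s
      seen-bottom : SeenAtBottom c₀ a b s
      seen-below : SeenBelow c₀ a s

  module SweepDownStep {c₀ a b q k c s} (inv : SweepDown c₀ a b q (suc k) c s)
                       (a≤k : a ≤ k) (k+2≤b : suc (suc k) ≤ b) (b≤m : b ≤ m) where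
    open SweepDown inv
    open AlterAt saturated k a≤k k+2≤b public

    inner₀ : Inner (c₀ a) (c₀ b) S
    inner₀ = Inner-agree agree inner

    q∈S : q ∈ S
    q∈S = subst (_∈ S) (sym (new-unique upper (q∈ (suc (suc k)) ≤-refl k+2≤b) (q∉ (suc k) (≤-trans a≤k (n≤1+n _)) ≤-refl))) y∈S

    unseen : ¬ (S ∈ˡ s)
    unseen S∈s with seen-q⇒ inner₀ q∈S S∈s
    ... | t , p<t , t≤b , S≡ct = off-chain t (≤-trans a≤k (≤-trans (n≤1+n _) (<⇒≤ p<t))) t≤b S≡ct

    seen-before : ∀ i → 1 ≤ i → i < suc k → star c i ∈ˡ s
    seen-before i 1≤i i<k+1 with <-cmp i a
    ... | tri< i<a _ _ = star-below-seen i i<a agree (seen-below i 1≤i i<a)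
    ... | tri≈ _ refl _ = star-bottom-seen 1≤i (≤-trans (s≤s a≤k) (≤-trans (n≤1+n _) k+2≤b)) agree saturated seen-bottom
    seen-before (suc i) _ i+1<k+1 | tri> _ _ a<i+1 = seen-¬q (Inner-agree agree At.inner) q∉star
      where
      module At = AlterAt saturated i (≤-pred a<i+1) (≤-trans i+1<k+1 (≤-trans (n≤1+n _) k+2≤b))
      q∉star : q ∉ star c (suc i)
      q∉star q∈ with At.∈S⁻ q∈
      ... | inj₁ q∈ci = q∉ i (≤-pred a<i+1) (≤-trans (n≤1+n i) (<⇒≤ i+1<k+1)) q∈ci
      ... | inj₂ q≡y = q∉ (suc (suc i)) (≤-trans (≤-pred a<i+1) (≤-trans (n≤1+n _) (n≤1+n _))) i+1<k+1
                          (subst (_∈ c (suc (suc i))) (sym q≡y) (new∈ At.upper))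

    next : SweepDown c₀ a b q k altered (S ∷ s)
    next = record
      { agree = Agree-trans agree (Agree-update (suc k) S (s≤s a≤k) k+2≤b)
      ; saturated = altered-saturated
      ; q∈ = q∈'
      ; q∉ = q∉'
      ; seen-¬q = λ inn q∉X → there (seen-¬q inn q∉X)
      ; seen-q⇒ = seen⇒
      ; seen-q⇐ = seen⇐
      ; seen-bottom = λ 1≤a A⋖Y Y⊆B → there (seen-bottom 1≤a A⋖Y Y⊆B)
      ; seen-below = λ i 1≤i i<a → there (seen-below i 1≤i i<a) }
      where
      q∈' : ∀ t → k < t → t ≤ b → q ∈ altered t
      q∈' t k<t t≤b with t ≟ suc k
      ... | yes refl rewrite update-eq c (suc k) S = q∈S
      ... | no t≢k+1 rewrite update-ne c (suc k) S t t≢k+1 = q∈ t (≤∧≢⇒< k<t (λ e → t≢k+1 (sym e))) t≤b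
      q∉' : ∀ t → a ≤ t → t ≤ k → q ∉ altered t
      q∉' t a≤t t≤k rewrite update-ne c (suc k) S t (<⇒≢ (s≤s t≤k)) = q∉ t a≤t (≤-trans t≤k (n≤1+n _))
      seen⇒ : ∀ {X} → Inner (c₀ a) (c₀ b) X → q ∈ X → X ∈ˡ (S ∷ s) → ∃ λ t → k < t × t ≤ b × X ≡ altered t
      seen⇒ inn q∈X (here X≡S) = suc k , ≤-refl , ≤-trans (n≤1+n _) k+2≤b , trans X≡S (sym (update-eq c (suc k) S))
      seen⇒ inn q∈X (there X∈s) with seen-q⇒ inn q∈X X∈s
      ... | t , p<t , t≤b , X≡ct = t , <-trans (n<1+n _) p<t , t≤b , trans X≡ct (sym (update-ne c (suc k) S t (λ e → <⇒≢ p<t (sym e))))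
      seen⇐ : ∀ t → k < t → t ≤ b → altered t ∈ˡ (S ∷ s)
      seen⇐ t k<t t≤b with t ≟ suc k
      ... | yes refl = here (update-eq c (suc k) S)
      ... | no t≢k+1 rewrite update-ne c (suc k) S t t≢k+1 = there (seen-q⇐ t (≤∧≢⇒< k<t (λ e → t≢k+1 (sym e))) t≤b)

    index : Index m (suc k)
    index = s≤s z≤n , ≤-trans k+2≤b b≤m

  abstract
   sweep-down : ∀ r {c₀ a b q p c s} → p ≡ r + a → p < b → b ≤ m → SweepDown c₀ a b q p c s →
     Swept minSel (SweepDown c₀ a b q a) (c₀ a) (c₀ b) c s (descending a r)
   sweep-down zero refl _ _ inv = record { trace = done ; extends = Extends-refl ; invariant = inv }
   sweep-down (suc r) {c₀} {a} {b} {q} {c = c} {s} refl p<b b≤m inv =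
     record { c' = c' ; s' = s' ; trace = humble-step index unseen seen-before trace
            ; extends = Extends-cons inner₀ extends ; invariant = invariant }
     where
     open SweepDownStep inv (m≤n+m a r) p<b b≤m
     rest : Swept minSel (SweepDown c₀ a b q a) (c₀ a) (c₀ b) altered (S ∷ s) (descending a r)
     rest = sweep-down r refl (<-trans (n<1+n _) p<b) b≤m next
     open Swept rest

  HumbleVisits : ℕ → Set
  HumbleVisits e = ∀ {a b} {c : Chain m} {s} → b ≡ suc (e + a) → b ≤ m → Saturated c a b →
    OnlyChainSeen c a b s → ChainSeen c a b s → SeenAtBottom c a b s → SeenBelow c a s →
    Visit minSel c s a b (humbleSeq a e)

  -- The induction step on [a,b] with b = a+e+2: visit [a,b-1], sweep the
  -- element q added at b-1 to the bottom, visit [a+1,b] of the new chain.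
  module HumbleStep (e : ℕ) (IH : HumbleVisits e) {a} {c : Chain m} {s}
    (b≤m : suc (suc (e + a)) ≤ m) (sat : Saturated c a (suc (suc (e + a))))
    (only : OnlyChainSeen c a (suc (suc (e + a))) s) (seen : ChainSeen c a (suc (suc (e + a))) s)
    (bottom : SeenAtBottom c a (suc (suc (e + a))) s) (below : SeenBelow c a s) where

    b b' : ℕ
    b = suc (suc (e + a))
    b' = suc (e + a)

    a≤b' : a ≤ b'
    a≤b' = ≤-trans (m≤n+m a e) (n≤1+n _)

    a<b : a < b
    a<b = s≤s a≤b'

    top : c b' ⋖ c b
    top = sat b' a≤b' ≤-refl

    q : Fin m
    q = new top

    -- Phase 1: the inner sets of [a,b-1] are those of [a,b] avoiding q.
    inner-down : ∀ {X} → Inner (c a) (c b') X → Inner (c a) (c b) X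
    inner-down (A⊆X , X⊆B , z) = A⊆X , (λ p → ⊆-cover top (X⊆B p)) , z

    only₁ : OnlyChainSeen c a b' s
    only₁ inn X∈s with only (inner-down inn) X∈s
    ... | t , a<t , t≤b , X≡ct with t ≟ b
    ... | yes refl = ⊥-elim (new∉ top (proj₁ (proj₂ inn) (subst (q ∈_) (sym X≡ct) (new∈ top))))
    ... | no t≢b = t , a<t , ≤-pred (≤∧≢⇒< t≤b t≢b) , X≡ct

    module R₁ = Visit (IH refl (≤-trans (n≤1+n _) b≤m) (saturated-sub sat ≤-refl (n≤1+n _)) only₁
                         (λ t a<t t≤b' → seen t a<t (≤-trans t≤b' (n≤1+n _)))
                         (λ 1≤a A⋖Y Y⊆B → bottom 1≤a A⋖Y (λ p → ⊆-cover top (Y⊆B p))) below)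
    c₁ : Chain m
    c₁ = R₁.c'
    s₁ : List (Subset m)
    s₁ = R₁.s'

    c₁a≡ : c₁ a ≡ c a
    c₁a≡ = R₁.agree a (inj₁ ≤-refl)
    c₁b'≡ : c₁ b' ≡ c b'
    c₁b'≡ = R₁.agree b' (inj₂ ≤-refl)
    c₁b≡ : c₁ b ≡ c b
    c₁b≡ = R₁.agree b (inj₂ (n≤1+n _))

    sat₁ : Saturated c₁ a b
    sat₁ = saturated-top c₁ a b' R₁.saturated (⋖-transport c c₁ b' c₁b'≡ c₁b≡ top)

    seen-¬q₁ : ∀ {X} → Inner (c a) (c b) X → q ∉ X → X ∈ˡ s₁
    seen-¬q₁ {X} (A⊆X , X⊆B , z) q∉X = R₁.all-seen (A⊆X , X⊆B' , z)
      where
      X⊆B' : X ⊆ c b'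
      X⊆B' {x} x∈X with x ∈? c b'
      ... | yes x∈B' = x∈B'
      ... | no x∉B' = ⊥-elim (q∉X (subst (_∈ X) (new-unique top (X⊆B x∈X) x∉B') x∈X))

    seen-q₁ : ∀ {X} → Inner (c a) (c b) X → q ∈ X → X ∈ˡ s₁ → X ≡ c₁ b
    seen-q₁ inn q∈X X∈s₁ with proj₂ R₁.extends X∈s₁
    ... | inj₂ inn' = ⊥-elim (new∉ top (proj₁ (proj₂ inn') q∈X))
    ... | inj₁ X∈s with only inn X∈s
    ... | t , a<t , t≤b , X≡ct with t ≟ b
    ... | yes refl = trans X≡ct (sym c₁b≡)
    ... | no t≢b = ⊥-elim (new∉ top (saturated-mono b' sat (<⇒≤ a<t) (≤-pred (≤∧≢⇒< t≤b t≢b)) (n≤1+n _) (subst (q ∈_) X≡ct q∈X)))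

    bottom₁ : SeenAtBottom c₁ a b s₁
    bottom₁ 1≤a {Y} A⋖Y Y⊆B rewrite R₁.agree (a ∸ 1) (inj₁ (m∸n≤m a 1)) | c₁a≡ =
      proj₁ R₁.extends (bottom 1≤a A⋖Y (subst (Y ⊆_) c₁b≡ Y⊆B))

    start : SweepDown c₁ a b q b' c₁ s₁
    start = record
      { agree = Agree-refl
      ; saturated = sat₁
      ; q∈ = λ { t b'<t t≤b → subst (λ j → q ∈ c₁ j) (≤-antisym b'<t t≤b) (subst (q ∈_) (sym c₁b≡) (new∈ top)) }
      ; q∉ = λ t a≤t t≤b' q∈ → new∉ top (subst (q ∈_) c₁b'≡ (saturated-mono b' sat₁ a≤t t≤b' (n≤1+n _) q∈))
      ; seen-¬q = λ inn → seen-¬q₁ (Inner-≡ c₁a≡ c₁b≡ inn)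
      ; seen-q⇒ = λ inn q∈X X∈s₁ → b , ≤-refl , ≤-refl , seen-q₁ (Inner-≡ c₁a≡ c₁b≡ inn) q∈X X∈s₁
      ; seen-q⇐ = λ t b'<t t≤b → subst (λ j → c₁ j ∈ˡ s₁) (≤-antisym b'<t t≤b)
                                   (subst (_∈ˡ s₁) (sym c₁b≡) (proj₁ R₁.extends (seen b a<b ≤-refl)))
      ; seen-bottom = bottom₁
      ; seen-below = λ i 1≤i i<a → star-below-seen i i<a R₁.agree (proj₁ R₁.extends (below i 1≤i i<a)) }

    module R₂ = Swept (sweep-down (suc e) refl ≤-refl b≤m start)
    c₂ : Chain m
    c₂ = R₂.c'
    s₂ : List (Subset m)
    s₂ = R₂.s'
    open SweepDown R₂.invariant

    c₂a≡ : c₂ a ≡ c₁ a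
    c₂a≡ = agree a (inj₁ ≤-refl)
    c₂b≡ : c₂ b ≡ c₁ b
    c₂b≡ = agree b (inj₂ ≤-refl)
    bottom₂ : c₂ a ⋖ c₂ (suc a)
    bottom₂ = saturated a ≤-refl a<b
    a+1<b : suc a < b
    a+1<b = s≤s (s≤s (m≤n+m a e))
    q∈c₂a+1 : q ∈ c₂ (suc a)
    q∈c₂a+1 = q∈ (suc a) (n<1+n a) (<⇒≤ a+1<b)
    q∉c₂a : q ∉ c₂ a
    q∉c₂a = q∉ a ≤-refl ≤-refl

    -- Phase 3: the inner sets of [a+1,b] are those of [a,b] containing q.
    inner-up : ∀ {X} → Inner (c₂ (suc a)) (c₂ b) X → Inner (c₁ a) (c₁ b) X
    inner-up (A⊆X , X⊆B , z , z∈X , z∉A) =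
      (λ p → A⊆X (⊆-cover bottom₂ (subst (_ ∈_) (sym c₂a≡) p))) , (λ p → subst (_ ∈_) c₂b≡ (X⊆B p)) ,
      z , z∈X , (λ p → z∉A (⊆-cover bottom₂ (subst (_ ∈_) (sym c₂a≡) p)))

    only₃ : OnlyChainSeen c₂ (suc a) b s₂
    only₃ inn@(A⊆X , _ , z , z∈X , z∉A) X∈s₂ with seen-q⇒ (inner-up inn) (A⊆X q∈c₂a+1) X∈s₂
    ... | t , a<t , t≤b , X≡ct with t ≟ suc a
    ... | yes refl = ⊥-elim (z∉A (subst (z ∈_) X≡ct z∈X))
    ... | no t≢a+1 = t , ≤∧≢⇒< a<t (λ e → t≢a+1 (sym e)) , t≤b , X≡ct

    bottom₃ : SeenAtBottom c₂ (suc a) b s₂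
    bottom₃ _ {Y} A⋖Y Y⊆B = seen-¬q (A⊆Z , Z⊆B , new A⋖Y , y∈Z , y∉A) q∉Z
      where
      Z = c₂ a ∪ (Y ∩ ∁ (c₂ (suc a)))
      y∈Z : new A⋖Y ∈ Z
      y∈Z = x∈p∪q⁺ (inj₂ (x∈p∩q⁺ (new∈ A⋖Y , x∉p⇒x∈∁p (new∉ A⋖Y))))
      y∉A : new A⋖Y ∉ c₁ a
      y∉A p = new∉ A⋖Y (⊆-cover bottom₂ (subst (_ ∈_) (sym c₂a≡) p))
      A⊆Z : c₁ a ⊆ Z
      A⊆Z p = x∈p∪q⁺ (inj₁ (subst (_ ∈_) (sym c₂a≡) p))
      Z⊆B : Z ⊆ c₁ b
      Z⊆B p with x∈p∪q⁻ (c₂ a) _ p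
      ... | inj₁ z∈A = subst (_ ∈_) c₂b≡ (saturated-mono b saturated ≤-refl (<⇒≤ a<b) ≤-refl z∈A)
      ... | inj₂ d = subst (_ ∈_) c₂b≡ (Y⊆B (proj₁ (x∈p∩q⁻ _ _ d)))
      q∉Z : q ∉ Z
      q∉Z p with x∈p∪q⁻ (c₂ a) _ p
      ... | inj₁ q∈A = q∉c₂a q∈A
      ... | inj₂ d = x∈∁p⇒x∉p (proj₂ (x∈p∩q⁻ _ _ d)) q∈c₂a+1

    below₃ : SeenBelow c₂ (suc a) s₂
    below₃ i 1≤i i<a+1 with i ≟ a
    ... | yes refl = star-bottom-seen 1≤i a<b agree saturated seen-bottom
    ... | no i≢a = star-below-seen i (≤∧≢⇒< (≤-pred i<a+1) i≢a) agree (seen-below i 1≤i (≤∧≢⇒< (≤-pred i<a+1) i≢a))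

    module R₃ = Visit (IH (cong suc (sym (+-suc e a))) b≤m (saturated-sub saturated (n≤1+n a) ≤-refl) only₃
                         (λ t a+1<t t≤b → seen-q⇐ t (<-trans (n<1+n a) a+1<t) t≤b) bottom₃ below₃)

    c₂a+1⊆ : ∀ {X} → c a ⊆ X → q ∈ X → c₂ (suc a) ⊆ X
    c₂a+1⊆ {X} A⊆X q∈X = ⋖-squeeze bottom₂ (λ p → A⊆X (subst (_ ∈_) (trans c₂a≡ c₁a≡) p))
                                     (subst (_∈ X) (new-unique bottom₂ q∈c₂a+1 q∉c₂a) q∈X)

    seen-q₃ : ∀ {X} → Inner (c a) (c b) X → q ∈ X → X ∈ˡ R₃.s'
    seen-q₃ {X} (A⊆X , X⊆B , _) q∈X with ⊆-or-witness X (c₂ (suc a))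
    ... | inj₁ X⊆A' = proj₁ R₃.extends
      (subst (_∈ˡ s₂) (sym (⊆-antisym X⊆A' (c₂a+1⊆ A⊆X q∈X))) (seen-q⇐ (suc a) (n<1+n a) (<⇒≤ a+1<b)))
    ... | inj₂ (z , z∈X , z∉A') =
      R₃.all-seen (c₂a+1⊆ A⊆X q∈X , (λ p → subst (_ ∈_) (sym (trans c₂b≡ c₁b≡)) (X⊆B p)) , z , z∈X , z∉A')

    -- Every inner set has been seen: without q in phase 1, with q in phase 3.
    all-seen₃ : ∀ {X} → Inner (c a) (c b) X → X ∈ˡ R₃.s'
    all-seen₃ {X} inn with q ∈? X
    ... | no q∉X = proj₁ R₃.extends (proj₁ R₂.extends (seen-¬q₁ inn q∉X))
    ... | yes q∈X = seen-q₃ inn q∈X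

    visit : Visit minSel c s a b (humbleSeq a (suc e))
    visit = record
      { c' = R₃.c' ; s' = R₃.s'
      ; trace = R₁.trace ++ᵀ (R₂.trace ++ᵀ R₃.trace)
      ; extends = Extends-trans (Extends-weaken inner-down R₁.extends)
                   (Extends-trans (Extends-weaken (Inner-≡ c₁a≡ c₁b≡) R₂.extends)
                     (Extends-weaken (λ inn → Inner-≡ c₁a≡ c₁b≡ (inner-up inn)) R₃.extends))
      ; all-seen = all-seen₃
      ; agree = Agree-trans (Agree-widen R₁.agree ≤-refl (n≤1+n _)) (Agree-trans agree (Agree-widen R₃.agree (n≤1+n a) ≤-refl))
      ; saturated = saturated-bot R₃.c' a b R₃.saturated
                      (⋖-transport c₂ R₃.c' a (R₃.agree a (inj₁ (n≤1+n a))) (R₃.agree (suc a) (inj₁ ≤-refl)) bottom₂) }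

  humble-visits : ∀ e → HumbleVisits e
  humble-visits zero refl _ sat _ seen _ _ = visit-base sat seen
  humble-visits (suc e) refl b≤m sat only seen bottom below = HumbleStep.visit e (humble-visits e) b≤m sat only seen bottom below

descending-snoc : ∀ n a → descending (suc a) n ∷ʳ suc a ≡ descending a (suc n)
descending-snoc zero a = refl
descending-snoc (suc n) a = cong₂ _∷_ (cong suc (+-suc n a)) (descending-snoc n a)

reverse-ascending : ∀ n a → reverse (ascending (suc a) n) ≡ descending a n
reverse-ascending zero a = refl
reverse-ascending (suc n) a = begin
    reverse (suc a ∷ ascending (suc (suc a)) n)   ≡⟨ unfold-reverse (suc a) (ascending (suc (suc a)) n) ⟩
    reverse (ascending (suc (suc a)) n) ∷ʳ suc a  ≡⟨ cong (_∷ʳ suc a) (reverse-ascending n (suc a)) ⟩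
    descending (suc a) n ∷ʳ suc a                 ≡⟨ descending-snoc n a ⟩
    descending a (suc n)                          ∎
  where open ≡-Reasoning

reverse-greedySeq : ∀ e a → reverse (greedySeq a e) ≡ humbleSeq a e
reverse-greedySeq zero a = refl
reverse-greedySeq (suc e) a = begin
    reverse (greedySeq (suc a) e ++ (ascending (suc a) (suc e) ++ greedySeq a e))
  ≡⟨ reverse-++ (greedySeq (suc a) e) _ ⟩
    reverse (ascending (suc a) (suc e) ++ greedySeq a e) ++ reverse (greedySeq (suc a) e)
  ≡⟨ cong₂ _++_ (reverse-++ (ascending (suc a) (suc e)) (greedySeq a e)) (reverse-greedySeq e (suc a)) ⟩
    (reverse (greedySeq a e) ++ reverse (ascending (suc a) (suc e))) ++ humbleSeq (suc a) e
  ≡⟨ cong₂ (λ P Q → (P ++ Q) ++ humbleSeq (suc a) e) (reverse-greedySeq e a) (reverse-ascending (suc e) a) ⟩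
    (humbleSeq a e ++ descending a (suc e)) ++ humbleSeq (suc a) e
  ≡⟨ ++-assoc (humbleSeq a e) _ _ ⟩
    humbleSeq a (suc e)
  ∎
  where open ≡-Reasoning

module _ {m : ℕ} where

  ∈-initial⁺ : ∀ {x : Fin m} {i} → toℕ x < i → x ∈ initial m i
  ∈-initial⁺ {x} {i} x<i = lookup⇒[]= x _ (trans (lookup∘tabulate _ x) (Equivalence.to T-≡ (<⇒<ᵇ x<i)))

  ∈-initial⁻ : ∀ {x : Fin m} {i} → x ∈ initial m i → toℕ x < i
  ∈-initial⁻ {x} {i} p = <ᵇ⇒< _ _ (Equivalence.from T-≡ (trans (sym (lookup∘tabulate _ x)) ([]=⇒lookup p)))

  initial-saturated : Saturated (initial m) 0 m
  initial-saturated k _ k<m = cover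
    (λ p → ∈-initial⁺ (m<n⇒m<1+n (∈-initial⁻ p)))
    (fromℕ< k<m)
    (∈-initial⁺ (subst (_< suc k) (sym (Fin.toℕ-fromℕ< k<m)) ≤-refl))
    (λ p → <-irrefl (Fin.toℕ-fromℕ< k<m) (∈-initial⁻ p))
    (λ z∈ z∉ → Fin.toℕ-injective (trans (≤-antisym (≤-pred (∈-initial⁻ z∈)) (≮⇒≥ λ z<k → z∉ (∈-initial⁺ z<k)))
                                        (sym (Fin.toℕ-fromℕ< k<m))))

  initialSeen : List (Subset m)
  initialSeen = map (initial m) (map suc (upTo m))

  only-initial : OnlyChainSeen (initial m) 0 m initialSeen
  only-initial _ p with ∈-map⁻ (initial m) p
  ... | i , i∈ , X≡ with ∈-map⁻ suc i∈
  ... | j , j∈ , refl = suc j , s≤s z≤n , ∈-upTo⁻ j∈ , X≡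

  initial-seen : ChainSeen (initial m) 0 m initialSeen
  initial-seen (suc i) _ i<m = ∈-map⁺ (initial m) (∈-map⁺ suc (∈-upTo⁺ i<m))

  initial-J : computeJ (initial m) initialSeen ≡ indices m
  initial-J = J-full λ { (suc k) (_ , k+1<m) S∈ → unseen k k+1<m S∈ }
    where
    unseen : ∀ k → suc k < m → ¬ (star (initial m) (suc k) ∈ˡ initialSeen)
    unseen k k+1<m S∈ with only-initial (AlterAt.inner initial-saturated k z≤n k+1<m) S∈
    ... | t , _ , t≤m , S≡ = AlterAt.off-chain initial-saturated k z≤n k+1<m t z≤n t≤m S≡

  procedure-output : ∀ {sel G} → Visit sel (initial m) initialSeen 0 m G → procedure sel m (length G + 1) ≡ just G
  procedure-output {sel} {G} V = begin
      run sel (length G + 1) (initial m) initialSeen (indices m)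
    ≡⟨ cong (run sel (length G + 1) (initial m) initialSeen) (sym initial-J) ⟩
      run sel (length G + 1) (initial m) initialSeen (computeJ (initial m) initialSeen)
    ≡⟨ run-trace sel trace 1 ⟩
      Maybe.map (G ++_) (run sel 1 c' s' (computeJ c' s'))
    ≡⟨ cong (λ J → Maybe.map (G ++_) (run sel 1 c' s' J)) final-J ⟩
      just (G ++ [])
    ≡⟨ cong just (++-identityʳ G) ⟩
      just G
    ∎
    where
    open ≡-Reasoning
    open Visit V
    final-J : computeJ c' s' ≡ []
    final-J = J-empty λ { (suc k) (_ , k+1<m) → all-seen (Inner-agree agree (AlterAt.inner saturated k z≤n k+1<m)) }

-- For m = e+1, both loops visit [0,m] from the initial state (nothing lies
-- above m or below 0); the humble output is the reverse of the greedy one.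
lemma3p2 : (m : ℕ) → 2 ≤ m →
    ∃[ fuel ] ∃[ G ] (greedy m fuel ≡ just G × humble m fuel ≡ just (reverse G))
lemma3p2 (suc e) _ = length G + 1 , G , procedure-output greedy-visit , humble-output
  where
  G : List ℕ
  G = greedySeq 0 e
  m≡ : suc e ≡ suc (e + 0)
  m≡ = cong suc (sym (+-identityʳ e))
  greedy-visit : Visit maxSel (initial (suc e)) initialSeen 0 (suc e) G
  greedy-visit = greedy-visits e m≡ ≤-refl initial-saturated only-initial initial-seen
                   (λ m<m → ⊥-elim (<-irrefl refl m<m)) (λ i m<i i<m → ⊥-elim (<-asym m<i i<m))
  humble-visit : Visit minSel (initial (suc e)) initialSeen 0 (suc e) (humbleSeq 0 e)
  humble-visit = humble-visits e m≡ ≤-refl initial-saturated only-initial initial-seen (λ ()) (λ i _ ())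
  humble-output : humble (suc e) (length G + 1) ≡ just (reverse G)
  humble-output rewrite sym (length-reverse G) | reverse-greedySeq e 0 = procedure-output humble-visit
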